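{- Let $k \ge 4$ be an even integer and let $D$ be a $k$-quasi-transitive digraph with a unique initial strong component $C$. Then one of the following holds: (1) every vertex of $C$ is a $(k+1)$-king of $D$; (2) there are vertices $u_1, u_2, u_3 \in V(C)$ such that $u_1$ is a $(k+1)$-king of $D$, $u_2$ is a $(k+2)$-king of $D$, $(u_2,u_1) \in A(D)$, $d(u_2,u_3) = k+2$, and $u_3$ is a $2$-king of $D$; moreover, every vertex at distance $k+2$ from $u_2$ is a $3$-king of $D$.
   Context: All digraphs are finite, without loops and without multiple arcs in the same direction; paths are directed. For $u,v \in V(D)$, $d(u,v)$ is the length of a shortest directed $uv$-path ($\infty$ if none, $d(v,v)=0$). A vertex $v$ is an $r$-king of $D$ if $d(v,u) \le r$ for every $u \in V(D)$. $D$ is $k$-quasi-transitive if for every directed path $(v_0, \dots, v_k)$ of length $k$, $(v_0,v_k) \in A(D)$ or $(v_k,v_0) \in A(D)$. An initial strong component is a strong component with no arc entering it from outside. -}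

module Defs where

open import Level using (0ℓ)
open import Data.Nat using (ℕ; suc; _≤_)
open import Data.Fin using (Fin; inject₁) renaming (suc to fsuc)
open import Data.Product using (Σ; _×_; _,_; ∃)
open import Data.Sum using (_⊎_)
open import Data.Empty using (⊥)
open import Relation.Nullary using (¬_; Dec)
open import Relation.Binary.PropositionalEquality using (_≡_)
open import Function.Definitions using (Injective)
open import Function.Bundles using (_⇔_)

-- Multiple arcs in the same
-- direction are excluded automatically since A(D) is a relation.
record Digraph : Set₁ where
  field
    n        : ℕ
    Arc      : Fin n → Fin n → Set
    arc?     : (u v : Fin n) → Dec (Arc u v)
    loopless : (v : Fin n) → ¬ Arc v v

module _ (D : Digraph) where
  open Digraph D

  Vertex : Set
  Vertex = Fin n

  record Path (m : ℕ) : Set where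
    field
      vtx      : Fin (suc m) → Vertex
      distinct : Injective _≡_ _≡_ vtx
      arcs     : (i : Fin m) → Arc (vtx (inject₁ i)) (vtx (fsuc i))

  open Path public

  PathFromTo : ℕ → Vertex → Vertex → Set
  PathFromTo m u v =
    Σ (Path m) λ p → (vtx p Data.Fin.zero ≡ u) × (vtx p (Data.Fin.fromℕ m) ≡ v)

  DistLe : Vertex → Vertex → ℕ → Set
  DistLe u v r = Σ ℕ λ m → (m ≤ r) × PathFromTo m u v

  DistEq : Vertex → Vertex → ℕ → Set
  DistEq u v m = PathFromTo m u v × ((l : ℕ) → suc l ≤ m → ¬ PathFromTo l u v)

  IsKing : ℕ → Vertex → Set
  IsKing r v = (u : Vertex) → DistLe v u r

  IsQuasiTransitive : ℕ → Set
  IsQuasiTransitive k = (p : Path k) →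
    Arc (vtx p Data.Fin.zero) (vtx p (Data.Fin.fromℕ k))
      ⊎ Arc (vtx p (Data.Fin.fromℕ k)) (vtx p Data.Fin.zero)

  Reaches : Vertex → Vertex → Set
  Reaches u v = ∃ λ m → PathFromTo m u v

  record IsStrongComponent (C : Vertex → Set) : Set where
    field
      nonempty : ∃ C
      strong   : ∀ {x y} → C x → C y → Reaches x y
      maximal  : ∀ {x y} → C x → Reaches x y → Reaches y x → C y

  record IsInitialStrongComponent (C : Vertex → Set) : Set where
    field
      isSC     : IsStrongComponent C
      noEnter  : ∀ {x y} → ¬ C x → C y → ¬ Arc x y

  IsUniqueInitialStrongComponent : (Vertex → Set) → Set₁
  IsUniqueInitialStrongComponent C =
    IsInitialStrongComponent C ×
    ((C' : Vertex → Set) → IsInitialStrongComponent C' → (v : Vertex) → (C' v ⇔ C v))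

module Submission where

-- Let v be a vertex reaching all of D, ℓ the distance from v, and write k = 4 + h.  A path of
-- length k whose ends lie two levels apart yields, by k-quasi-transitivity, an arc from the
-- higher end to the lower one.  Combining such paths along geodesics from v (the base case of
-- this induction is where k even is used) shows that a vertex w with ℓ w ≥ k + 2 has an arc to
-- every vertex two or more levels below it.  Hence such a w on a deepest level is a 3-king, any
-- two vertices on a common level ≥ k + 2 are adjacent, and so a deepest level ≥ k + 2 contains
-- a 2-king (Landau).  Every vertex of the unique initial strong component C reaches all of D.
-- If some c ∈ C is not a (k+1)-king, a deepest vertex w₀ from c is a 3-king, so a geodesic from
-- c to w₀ contains an arc u₂u₁ from a non-(k+1)-king to a (k+1)-king.  Then u₂ is a
-- (k+2)-king whose deepest level is exactly k + 2, and the 2-king u₃ of that level has an arc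
-- to u₂, which puts it in C.

open import Defs
open import Data.Nat using (ℕ; zero; suc; _+_; _*_; _≤_; _<_; z≤n; s≤s) renaming (_≟_ to _≟ℕ_)
open import Data.Nat.Properties hiding (_≟_)
open import Data.Nat.Divisibility using (_∣_; divides; ∣m+n∣m⇒∣n)
open import Data.Nat.Induction using (<-wellFounded; <-rec)
open import Data.Nat.Tactic.RingSolver using (solve)
open import Data.Fin using (Fin; toℕ; inject₁; fromℕ; _≟_) renaming (zero to fzero; suc to fsuc)
open import Data.Fin.Properties
  using (toℕ-injective; toℕ≤pred[n]; toℕ<n; toℕ-inject₁; toℕ-fromℕ; injective⇒≤; any?; all?; ¬∀⟶∃¬)
open import Data.Fin.Subset using (Subset; ∣_∣) renaming (_∈_ to _∈ₛ_)
open import Data.Fin.Subset.Properties using (p⊂q⇒∣p∣<∣q∣)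
import Data.Vec as Vec
open import Data.Vec.Properties using (lookup⇒[]=; []=⇒lookup; lookup∘tabulate)
open import Data.List using (List; _∷_; []; filter; allFin)
open import Data.List.Extrema.Nat using (argmax; argmax-all; f[xs]≤f[argmax])
import Data.List.Relation.Unary.All as All
open import Data.List.Relation.Unary.All.Properties using (all-filter)
open import Data.List.Membership.Propositional.Properties using (∈-filter⁺; ∈-allFin)
open import Data.Product using (Σ; _×_; _,_; ∃-syntax; proj₁; proj₂)
open import Data.Sum using (_⊎_; inj₁; inj₂; swap; [_,_])
import Data.Sum as Sum
open import Data.Empty using (⊥-elim)
open import Data.Unit using (⊤; tt)
open import Function using (_∘_; id; case_of_)
open import Function.Bundles using (Equivalence)
open import Induction.WellFounded using (Acc; acc)
open import Relation.Nullary using (¬_; Dec; yes; no; does)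
open import Relation.Nullary.Decidable using (_×-dec_; _⊎-dec_; ¬?; map′; dec-true; decidable-stable)
open import Relation.Unary using (Decidable)
open import Relation.Binary.Definitions using (tri<; tri≈; tri>)
open import Relation.Binary.PropositionalEquality
  using (_≡_; _≢_; refl; sym; trans; cong; subst; subst₂; module ≡-Reasoning)
open ≡-Reasoning

≤-by : ∀ {x y} d → x + d ≡ y → x ≤ y
≤-by {x} d x+d≡y = subst (x ≤_) x+d≡y (m≤m+n x d)

downward-induction : ∀ {P : ℕ → Set} {n} → P n → (∀ {i} → i < n → P (suc i) → P i) →
                     ∀ {i} → i ≤ n → P i
downward-induction {P} {n} Pn step i≤n = go _ (proj₂ (m≤n⇒∃[o]m+o≡n i≤n))
  where
    go : ∀ d {i} → i + d ≡ n → P i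
    go zero    {i} i+0≡n = subst P (trans (sym i+0≡n) (+-identityʳ i)) Pn
    go (suc d) {i} i+d≡n = step (≤-by d i+1+d≡n) (go d i+1+d≡n)
      where
        i+1+d≡n : suc i + d ≡ n
        i+1+d≡n = trans (sym (+-suc i d)) i+d≡n

module _ {A : Set} where

  Chain : (A → A → Set) → (ℕ → A) → ℕ → Set
  Chain R f m = ∀ {i} → i < m → R (f i) (f (suc i))

  InjectiveOn : (ℕ → A) → ℕ → Set
  InjectiveOn f m = ∀ {i j} → i ≤ m → j ≤ m → f i ≡ f j → i ≡ j

  infixr 5 _◃_

  _◃_ : A → (ℕ → A) → ℕ → A
  (x ◃ f) zero    = x
  (x ◃ f) (suc i) = f i

  ◃-chain : ∀ {R x f m} → R x (f 0) → Chain R f m → Chain R (x ◃ f) (suc m)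
  ◃-chain r c {zero}  _         = r
  ◃-chain r c {suc i} (s≤s i<m) = c i<m

  ◃-injectiveOn : ∀ {x f m} → (∀ {i} → i ≤ m → f i ≢ x) → InjectiveOn f m →
                  InjectiveOn (x ◃ f) (suc m)
  ◃-injectiveOn x∉f inj {zero}  {zero}  _         _         _  = refl
  ◃-injectiveOn x∉f inj {zero}  {suc j} _         (s≤s j≤m) eq = ⊥-elim (x∉f j≤m (sym eq))
  ◃-injectiveOn x∉f inj {suc i} {zero}  (s≤s i≤m) _         eq = ⊥-elim (x∉f i≤m eq)
  ◃-injectiveOn x∉f inj {suc i} {suc j} (s≤s i≤m) (s≤s j≤m) eq = cong suc (inj i≤m j≤m eq)

  splice : ℕ → (ℕ → A) → (ℕ → A) → ℕ → A
  splice zero    f g = f 0 ◃ g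
  splice (suc p) f g = f 0 ◃ splice p (f ∘ suc) g

  splice-left : ∀ p {f g i} → i ≤ p → splice p f g i ≡ f i
  splice-left zero    {i = zero}  z≤n       = refl
  splice-left (suc p) {i = zero}  z≤n       = refl
  splice-left (suc p) {i = suc i} (s≤s i≤p) = splice-left p i≤p

  splice-right : ∀ p {f g} j → splice p f g (suc p + j) ≡ g j
  splice-right zero    j = refl
  splice-right (suc p) j = splice-right p j

  data Split (p : ℕ) : ℕ → Set where
    left  : ∀ {i} → i ≤ p → Split p i
    right : ∀ j → Split p (suc p + j)

  split : ∀ p i → Split p i
  split p i with i ≤? p
  ... | yes i≤p = left i≤p
  ... | no  i≰p with m≤n⇒∃[o]m+o≡n (≰⇒> i≰p)
  ...   | j , refl = right j

  splice-all : ∀ {P : A → Set} p q {f g} → (∀ {i} → i ≤ p → P (f i)) → (∀ {j} → j ≤ q → P (g j)) →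
               ∀ {i} → i ≤ suc p + q → P (splice p f g i)
  splice-all {P} p q Pf Pg {i} i≤ with split p i
  ... | left i≤p = subst P (sym (splice-left p i≤p)) (Pf i≤p)
  ... | right j  = subst P (sym (splice-right p j)) (Pg (+-cancelˡ-≤ (suc p) j q i≤))

  splice-chain : ∀ {R} p q {f g} → Chain R f p → R (f p) (g 0) → Chain R g q →
                 Chain R (splice p f g) (suc p + q)
  splice-chain {R} zero    q     cf r cg = ◃-chain {R} r cg
  splice-chain {R} (suc p) q {f} cf r cg =
    ◃-chain {R} (subst (R (f 0)) (sym (splice-left p z≤n)) (cf (s≤s z≤n)))
                (splice-chain {R} p q (cf ∘ s≤s) r cg)

  splice-injectiveOn : ∀ p q {f g} → InjectiveOn f p → InjectiveOn g q →
                       (∀ {i j} → i ≤ p → j ≤ q → f i ≢ g j) →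
                       InjectiveOn (splice p f g) (suc p + q)
  splice-injectiveOn p q {f} {g} inj-f inj-g disjoint {i} {j} i≤ j≤ eq with split p i | split p j
  ... | left i≤p | left j≤p =
    inj-f i≤p j≤p (trans (sym (splice-left p i≤p)) (trans eq (splice-left p j≤p)))
  ... | left i≤p | right j′ = ⊥-elim (disjoint i≤p (+-cancelˡ-≤ (suc p) j′ q j≤)
    (trans (sym (splice-left p i≤p)) (trans eq (splice-right p j′))))
  ... | right i′ | left j≤p = ⊥-elim (disjoint j≤p (+-cancelˡ-≤ (suc p) i′ q i≤)
    (trans (sym (splice-left p j≤p)) (trans (sym eq) (splice-right p i′))))
  ... | right i′ | right j′ = cong (suc p +_)
    (inj-g (+-cancelˡ-≤ (suc p) i′ q i≤) (+-cancelˡ-≤ (suc p) j′ q j≤)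
           (trans (sym (splice-right p i′)) (trans eq (splice-right p j′))))

module _ {n : ℕ} where

  maximiser : ∀ {P : Fin n → Set} → Decidable P → (f : Fin n → ℕ) → ∀ {x₀} → P x₀ →
              ∃[ u ] P u × (∀ {t} → P t → f t ≤ f u)
  maximiser P? f {x₀} Px₀ =
    argmax f x₀ candidates , argmax-all f Px₀ (all-filter P? (allFin n)) ,
    λ Pt → All.lookup (f[xs]≤f[argmax] x₀ candidates) (∈-filter⁺ P? (∈-allFin _) Pt)
    where
      candidates : List (Fin n)
      candidates = filter P? (allFin n)

  maximum : (f : Fin n → ℕ) → Fin n → ∃[ u ] (∀ t → f t ≤ f u)
  maximum f x₀ with maximiser {P = λ _ → ⊤} (λ _ → yes tt) f {x₀} tt
  ... | u , _ , most = u , λ t → most {t} tt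

  subset : {P : Fin n → Set} → Decidable P → Subset n
  subset P? = Vec.tabulate (does ∘ P?)

  ∈-subset⁺ : ∀ {P : Fin n → Set} (P? : Decidable P) {x} → P x → x ∈ₛ subset P?
  ∈-subset⁺ P? {x} Px = lookup⇒[]= x _ (trans (lookup∘tabulate _ x) (dec-true (P? x) Px))

  ∈-subset⁻ : ∀ {P : Fin n → Set} (P? : Decidable P) {x} → x ∈ₛ subset P? → P x
  ∈-subset⁻ P? {x} x∈ with P? x | trans (sym (lookup∘tabulate (does ∘ P?) x)) ([]=⇒lookup x∈)
  ... | yes Px | _  = Px
  ... | no  _  | ()

  count : {P : Fin n → Set} → Decidable P → ℕ
  count P? = ∣ subset P? ∣

  count-< : ∀ {P Q : Fin n → Set} (P? : Decidable P) (Q? : Decidable Q) →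
            (∀ {x} → P x → Q x) → ∀ {y} → Q y → ¬ P y → count P? < count Q?
  count-< P? Q? P⊆Q {y} Qy ¬Py = p⊂q⇒∣p∣<∣q∣
    ( (λ x∈P → ∈-subset⁺ Q? (P⊆Q (∈-subset⁻ P? x∈P)))
    , y , ∈-subset⁺ Q? Qy , ¬Py ∘ ∈-subset⁻ P? )

module _ (D : Digraph) where
  open Digraph D using (n; Arc; arc?; loopless)

  infix 4 _⇝[_]_ _⇝_

  _⇝[_]_ : Vertex D → ℕ → Vertex D → Set
  u ⇝[ zero  ] v = u ≡ v
  u ⇝[ suc r ] v = u ≡ v ⊎ ∃[ x ] u ⇝[ r ] x × Arc x v

  ⇝-refl : ∀ r {u} → u ⇝[ r ] u
  ⇝-refl zero    = refl
  ⇝-refl (suc r) = inj₁ refl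

  ⇝-snoc : ∀ {r u x v} → u ⇝[ r ] x → Arc x v → u ⇝[ suc r ] v
  ⇝-snoc w a = inj₂ (_ , w , a)

  ⇝-mono : ∀ {r s u v} → r ≤ s → u ⇝[ r ] v → u ⇝[ s ] v
  ⇝-mono {zero}  {zero}  _         w                  = w
  ⇝-mono {zero}  {suc s} _         refl               = inj₁ refl
  ⇝-mono {suc r} {suc s} _         (inj₁ u≡v)         = inj₁ u≡v
  ⇝-mono {suc r} {suc s} (s≤s r≤s) (inj₂ (x , w , a)) = ⇝-snoc (⇝-mono r≤s w) a

  ⇝-trans : ∀ {r s u x v} → u ⇝[ r ] x → x ⇝[ s ] v → u ⇝[ r + s ] v
  ⇝-trans {r} {zero}  w refl        = ⇝-mono (m≤m+n r 0) w
  ⇝-trans {r} {suc s} w (inj₁ refl) = ⇝-mono (m≤m+n r (suc s)) w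
  ⇝-trans {r} {suc s} {u} {v = v} w (inj₂ (y , w′ , a)) =
    subst (u ⇝[_] v) (sym (+-suc r s)) (⇝-snoc (⇝-trans w w′) a)

  ⇝-cons : ∀ {r u x v} → Arc u x → x ⇝[ r ] v → u ⇝[ suc r ] v
  ⇝-cons a w = ⇝-trans {1} (⇝-snoc refl a) w

  walk? : ∀ u r v → Dec (u ⇝[ r ] v)
  walk? u zero    v = u ≟ v
  walk? u (suc r) v = (u ≟ v) ⊎-dec any? (λ x → walk? u r x ×-dec arc? x v)

  sequencePath : ∀ (f : ℕ → Vertex D) m → Chain Arc f m → InjectiveOn f m →
                 PathFromTo D m (f 0) (f m)
  sequencePath f m arcs inj = path , refl , cong f (toℕ-fromℕ m)
    where
      path : Path D m
      path = record
        { vtx      = f ∘ toℕ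
        ; distinct = λ eq → toℕ-injective (inj (toℕ≤pred[n] _) (toℕ≤pred[n] _) eq)
        ; arcs     = λ i → subst (λ j → Arc (f j) (f (suc (toℕ i)))) (sym (toℕ-inject₁ i))
                                 (arcs (toℕ<n i))
        }

  path⇒walk : ∀ {m u v} → PathFromTo D m u v → u ⇝[ m ] v
  path⇒walk {m} (p , refl , refl) = walk m (vtx p) (arcs p)
    where
      walk : ∀ m (f : Fin (suc m) → Vertex D) → (∀ i → Arc (f (inject₁ i)) (f (fsuc i))) →
             f fzero ⇝[ m ] f (fromℕ m)
      walk zero    f arcs = refl
      walk (suc m) f arcs = ⇝-cons (arcs fzero) (walk m (f ∘ fsuc) (arcs ∘ fsuc))

  module Distance (v : Vertex D) where

    IsDistance : Vertex D → ℕ → Set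
    IsDistance z r = v ⇝[ r ] z × (∀ {s} → s < r → ¬ v ⇝[ s ] z)

    shortest : ∀ {r z} → v ⇝[ r ] z → ∃[ s ] s ≤ r × IsDistance z s
    shortest {zero}      w = 0 , z≤n , w , λ ()
    shortest {suc r} {z} w with walk? v r z
    ... | yes w′ = let s , s≤r , d = shortest w′ in s , m≤n⇒m≤1+n s≤r , d
    ... | no  ¬w′ = suc r , ≤-refl , w , λ s<1+r w″ → ¬w′ (⇝-mono (≤-pred s<1+r) w″)

    IsDistance-unique : ∀ {z r s} → IsDistance z r → IsDistance z s → r ≡ s
    IsDistance-unique {r = r} {s} (wr , minr) (ws , mins) with <-cmp r s
    ... | tri< r<s _ _ = ⊥-elim (mins r<s wr)
    ... | tri≈ _ r≡s _ = r≡s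
    ... | tri> _ _ s<r = ⊥-elim (minr s<r ws)

    parent : ∀ {z t} → IsDistance z (suc t) → ∃[ x ] IsDistance x t × Arc x z
    parent (inj₁ v≡z , min)         = ⊥-elim (min (s≤s z≤n) v≡z)
    parent (inj₂ (x , w , a) , min) = x , (w , λ s<t w′ → min (s≤s s<t) (⇝-snoc w′ a)) , a

    record Geodesic (t : ℕ) : Set where
      field
        vertex     : ℕ → Vertex D
        isDistance : ∀ {i} → i ≤ t → IsDistance (vertex i) i
        arc        : Chain Arc vertex t

      injective : InjectiveOn vertex t
      injective i≤t j≤t eq =
        IsDistance-unique (isDistance i≤t) (subst (λ x → IsDistance x _) (sym eq) (isDistance j≤t))

      start : v ≡ vertex 0
      start = proj₁ (isDistance z≤n)

      path : PathFromTo D t v (vertex t)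
      path = subst (λ x → PathFromTo D t x (vertex t)) (sym start) (sequencePath vertex t arc injective)

    geodesic : ∀ {z t} → IsDistance z t → Σ (Geodesic t) λ γ → Geodesic.vertex γ t ≡ z
    geodesic {z} {zero} d =
      record { vertex = λ _ → z ; isDistance = λ { z≤n → d } ; arc = λ () } , refl
    geodesic {z} {suc t} d with parent d
    ... | x , dx , x→z with geodesic dx
    ...   | γ , γt≡x = extended , extended-top
      where
        open Geodesic γ
        g : ℕ → Vertex D
        g = splice t vertex (λ _ → z)
        extended-top : g (suc t) ≡ z
        extended-top = trans (cong g (sym (+-identityʳ (suc t)))) (splice-right t 0)
        extended : Geodesic (suc t)
        extended = record
          { vertex     = g
          ; isDistance = λ {i} i≤ → case m≤n⇒m<n∨m≡n i≤ of λ
              { (inj₁ i<)   → subst (λ y → IsDistance y i) (sym (splice-left t (≤-pred i<)))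
                                    (isDistance (≤-pred i<))
              ; (inj₂ refl) → subst (λ y → IsDistance y (suc t)) (sym extended-top) d }
          ; arc        = subst (Chain Arc g) (+-identityʳ (suc t))
              (splice-chain {R = Arc} t 0 arc (subst (λ y → Arc y z) (sym γt≡x) x→z) (λ ()))
          }

    walk⇒distLe : ∀ {r z} → v ⇝[ r ] z → DistLe D v z r
    walk⇒distLe w with shortest w
    ... | s , s≤r , d with geodesic d
    ...   | γ , γs≡z = s , s≤r , subst (PathFromTo D s v) γs≡z (Geodesic.path γ)

  _⇝_ : Vertex D → Vertex D → Set
  u ⇝ v = ∃[ r ] u ⇝[ r ] v

  reach-refl : ∀ {u} → u ⇝ u
  reach-refl = 0 , refl

  reach-trans : ∀ {u x v} → u ⇝ x → x ⇝ v → u ⇝ v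
  reach-trans (r , w) (s , w′) = r + s , ⇝-trans w w′

  arc⇒reach : ∀ {u v} → Arc u v → u ⇝ v
  arc⇒reach a = 1 , ⇝-snoc refl a

  reaches⇒reach : ∀ {u v} → Reaches D u v → u ⇝ v
  reaches⇒reach (m , p) = m , path⇒walk p

  reach⇒reaches : ∀ {u v} → u ⇝ v → Reaches D u v
  reach⇒reaches (r , w) with Distance.walk⇒distLe _ w
  ... | s , _ , p = s , p

  reach⇒⇝[n] : ∀ {u v} → u ⇝ v → u ⇝[ n ] v
  reach⇒⇝[n] (r , w) with Distance.walk⇒distLe _ w
  ... | s , _ , p = ⇝-mono (<⇒≤ (injective⇒≤ (distinct (proj₁ p)))) (path⇒walk p)

  reach? : ∀ u v → Dec (u ⇝ v)
  reach? u v = map′ (n ,_) reach⇒⇝[n] (walk? u n v)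

  crossing-arc : ∀ {P : Vertex D → Set} → Decidable P → ∀ {r u v} → u ⇝[ r ] v → ¬ P u → P v →
                 ∃[ x ] ∃[ y ] Arc x y × ¬ P x × P y × y ⇝ v
  crossing-arc P? {zero}  refl                 ¬Pu Pv = ⊥-elim (¬Pu Pv)
  crossing-arc P? {suc r} (inj₁ refl)          ¬Pu Pv = ⊥-elim (¬Pu Pv)
  crossing-arc P? {suc r} (inj₂ (x , w , x→v)) ¬Pu Pv with P? x
  ... | no  ¬Px = x , _ , x→v , ¬Px , Pv , reach-refl
  ... | yes Px  = let a , b , a→b , ¬Pa , Pb , b⇝x = crossing-arc P? w ¬Pu Px
                  in a , b , a→b , ¬Pa , Pb , reach-trans b⇝x (arc⇒reach x→v)

  -- Landau's theorem; u is a vertex of T with the most out-neighbours in T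
  semicomplete-king : ∀ {T : Vertex D → Set} → Decidable T →
                      (∀ {x y} → T x → T y → x ≢ y → Arc x y ⊎ Arc y x) →
                      ∀ {x₀} → T x₀ → ∃[ u ] T u × ∀ {t} → T t → u ⇝[ 2 ] t
  semicomplete-king {T} T? adjacent Tx₀ =
    let u , Tu , most = maximiser T? outdegree Tx₀ in u , Tu , king Tu most
    where
      out? : ∀ x → Decidable (λ y → T y × Arc x y)
      out? x y = T? y ×-dec arc? x y

      outdegree : Vertex D → ℕ
      outdegree x = count (out? x)

      king : ∀ {u} → T u → (∀ {t} → T t → outdegree t ≤ outdegree u) → ∀ {t} → T t → u ⇝[ 2 ] t
      king {u} Tu most {t} Tt with t ≟ u
      ... | yes refl = ⇝-refl 2
      ... | no  t≢u with arc? u t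
      ...   | yes u→t = ⇝-mono (s≤s z≤n) (⇝-snoc refl u→t)
      ...   | no  u↛t with any? (λ x → out? u x ×-dec ¬? (arc? t x))
      ...     | yes (x , (Tx , u→x) , t↛x) = ⇝-snoc (⇝-snoc refl u→x) x→t
        where
          x→t : Arc x t
          x→t = [ id , ⊥-elim ∘ t↛x ] (adjacent Tx Tt λ { refl → u↛t u→x })
      ...     | no  none =
        ⊥-elim (<⇒≱ (count-< (out? u) (out? t) dominated (Tu , t→u) (loopless u ∘ proj₂)) (most Tt))
        where
          t→u : Arc t u
          t→u = [ id , ⊥-elim ∘ u↛t ] (adjacent Tt Tu t≢u)
          dominated : ∀ {x} → T x × Arc u x → T x × Arc t x
          dominated {x} (Tx , u→x) = Tx , decidable-stable (arc? t x) λ t↛x → none (x , (Tx , u→x) , t↛x)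

  module InitialComponent (C : Vertex D → Set) (C-unique : IsUniqueInitialStrongComponent D C) where
    open IsInitialStrongComponent (proj₁ C-unique)
    open IsStrongComponent isSC

    IsSource : Vertex D → Set
    IsSource z = ∀ {x} → x ⇝ z → z ⇝ x

    sourceAbove : ∀ y → ∃[ z ] z ⇝ y × IsSource z
    sourceAbove y = descend y (<-wellFounded _)
      where
        ancestorCount : Vertex D → ℕ
        ancestorCount z = count (λ x → reach? x z)

        descend : ∀ z → Acc _<_ (ancestorCount z) → ∃[ s ] s ⇝ z × IsSource s
        descend z (acc smaller) with any? (λ x → reach? x z ×-dec ¬? (reach? z x))
        ... | yes (x , x⇝z , z↛x) =
          let fewer = count-< (λ t → reach? t x) (λ t → reach? t z) (λ t⇝x → reach-trans t⇝x x⇝z)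
                              reach-refl z↛x
              s , s⇝x , source = descend x (smaller fewer)
          in s , reach-trans s⇝x x⇝z , source
        ... | no  none = z , reach-refl , λ {x} x⇝z →
          decidable-stable (reach? z x) (λ z↛x → none (x , x⇝z , z↛x))

    source∈C : ∀ {z} → IsSource z → C z
    source∈C {z} source = Equivalence.to (proj₂ C-unique C′ initial z) (reach-refl , reach-refl)
      where
        C′ : Vertex D → Set
        C′ t = z ⇝ t × t ⇝ z
        initial : IsInitialStrongComponent D C′
        initial = record
          { isSC    = record
            { nonempty = z , reach-refl , reach-refl
            ; strong   = λ (_ , x⇝z) (z⇝y , _) → reach⇒reaches (reach-trans x⇝z z⇝y)
            ; maximal  = λ (z⇝x , x⇝z) x⇝y y⇝x →
                reach-trans z⇝x (reaches⇒reach x⇝y) , reach-trans (reaches⇒reach y⇝x) x⇝z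
            }
          ; noEnter = λ ¬C′x (_ , y⇝z) x→y →
              let x⇝z = reach-trans (arc⇒reach x→y) y⇝z in ¬C′x (source x⇝z , x⇝z)
          }

    member-reaches : ∀ {c} → C c → ∀ y → c ⇝ y
    member-reaches Cc y with sourceAbove y
    ... | z , z⇝y , source = reach-trans (reaches⇒reach (strong Cc (source∈C source))) z⇝y

    reaches-member : ∀ {x y} → C y → x ⇝ y → C x
    reaches-member Cy x⇝y = maximal Cy (reach⇒reaches (member-reaches Cy _)) (reach⇒reaches x⇝y)

  module Levels (v : Vertex D) (reachable : ∀ z → v ⇝ z) where
    open Distance v public

    ℓ : Vertex D → ℕ
    ℓ z = proj₁ (shortest (proj₂ (reachable z)))

    ℓ-isDistance : ∀ z → IsDistance z (ℓ z)
    ℓ-isDistance z = proj₂ (proj₂ (shortest (proj₂ (reachable z))))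

    ℓ-walk : ∀ z → v ⇝[ ℓ z ] z
    ℓ-walk z = proj₁ (ℓ-isDistance z)

    ℓ-minimal : ∀ {r z} → v ⇝[ r ] z → ℓ z ≤ r
    ℓ-minimal {r} {z} w = ≮⇒≥ λ r<ℓz → proj₂ (ℓ-isDistance z) r<ℓz w

    ℓ-unique : ∀ {z r} → IsDistance z r → ℓ z ≡ r
    ℓ-unique = IsDistance-unique (ℓ-isDistance _)

    ℓ-arc : ∀ {x y} → Arc x y → ℓ y ≤ suc (ℓ x)
    ℓ-arc {x} x→y = ℓ-minimal (⇝-snoc (ℓ-walk x) x→y)

    orient : ∀ {x y} → 2 + ℓ y ≤ ℓ x → Arc x y ⊎ Arc y x → Arc x y
    orient _   (inj₁ x→y) = x→y
    orient ℓ<ℓ (inj₂ y→x) = ⊥-elim (<⇒≱ ℓ<ℓ (ℓ-arc y→x))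

    geodesic-level : ∀ {t} (γ : Geodesic t) {i} → i ≤ t → ℓ (Geodesic.vertex γ i) ≡ i
    geodesic-level γ i≤t = ℓ-unique (Geodesic.isDistance γ i≤t)

    geodesicTo : ∀ z → Σ (Geodesic (ℓ z)) λ γ → Geodesic.vertex γ (ℓ z) ≡ z
    geodesicTo z = geodesic (ℓ-isDistance z)

    ℓ-path : ∀ z → PathFromTo D (ℓ z) v z
    ℓ-path z with geodesicTo z
    ... | γ , γ≡z = subst (PathFromTo D (ℓ z) v) γ≡z (Geodesic.path γ)

    level⇒distEq : ∀ {z r} → ℓ z ≡ r → DistEq D v z r
    level⇒distEq {z} refl = ℓ-path z , λ l l<ℓz p → <⇒≱ l<ℓz (ℓ-minimal (path⇒walk p))

    distEq⇒level : ∀ {z r} → DistEq D v z r → ℓ z ≡ r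
    distEq⇒level {z} (p , no-shorter) =
      ≤-antisym (ℓ-minimal (path⇒walk p)) (≮⇒≥ λ ℓz<r → no-shorter (ℓ z) ℓz<r (ℓ-path z))

    record Ascent (f : ℕ → Vertex D) (a m : ℕ) : Set where
      field
        level : ∀ {i} → i ≤ m → ℓ (f i) ≡ a + i
        arc   : Chain Arc f m

      injective : InjectiveOn f m
      injective i≤m j≤m eq =
        +-cancelˡ-≡ a _ _ (trans (sym (level i≤m)) (trans (cong ℓ eq) (level j≤m)))

    segment : ∀ {t} (γ : Geodesic t) {a m} → a + m ≤ t →
              Ascent (λ i → Geodesic.vertex γ (a + i)) a m
    segment γ {a} a+m≤t = record
      { level = λ i≤m → geodesic-level γ (≤-trans (+-monoʳ-≤ a i≤m) a+m≤t)
      ; arc   = λ {i} i<m → subst (λ j → Arc (vertex (a + i)) (vertex j)) (sym (+-suc a i))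
                                  (arc (≤-trans (+-monoʳ-< a i<m) a+m≤t))
      }
      where open Geodesic γ

  module QuasiTransitive (h : ℕ) (qt : IsQuasiTransitive D (4 + h)) where

    qt-sequence : ∀ {f m} → m ≡ 4 + h → Chain Arc f m → InjectiveOn f m →
                  Arc (f 0) (f m) ⊎ Arc (f m) (f 0)
    qt-sequence {f} refl arcs inj with sequencePath f (4 + h) arcs inj
    ... | p , p₀≡ , pₖ≡ = subst₂ (λ x y → Arc x y ⊎ Arc y x) p₀≡ pₖ≡ (qt p)

    module Rooted (v : Vertex D) (reachable : ∀ z → v ⇝ z) where
      open Levels v reachable public

      skip-back : ∀ {f a} → Ascent f a (4 + h) → Arc (f (4 + h)) (f 0)
      skip-back {f} {a} asc = orient climb (swap (qt-sequence refl arc injective))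
        where
          open Ascent asc
          climb : 2 + ℓ (f 0) ≤ ℓ (f (4 + h))
          climb = subst₂ (λ x y → 2 + x ≤ y) (sym (level z≤n)) (sym (level ≤-refl))
                         (≤-by (2 + h) (solve (a ∷ h ∷ [])))

      arc-to-end : ∀ {w f m} → m ≡ 3 + h → Arc w (f 0) → Chain Arc f m → InjectiveOn f m →
                   (∀ {i} → i ≤ m → ℓ (f i) < ℓ w) → 2 + ℓ (f m) ≤ ℓ w → Arc w (f m)
      arc-to-end {w} {f} refl w→f₀ arcs inj below far = orient far
        (qt-sequence {w ◃ f} refl (◃-chain {R = Arc} w→f₀ arcs)
          (◃-injectiveOn (λ i≤ fᵢ≡w → <-irrefl (cong ℓ fᵢ≡w) (below i≤)) inj))

      jump : ∀ {w f a} → Arc w (f 0) → Ascent f a (3 + h) → 2 + (a + (3 + h)) ≤ ℓ w →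
             Arc w (f (3 + h))
      jump {w} {f} {a} w→f₀ asc far = arc-to-end refl w→f₀ arc injective below
        (subst (λ x → 2 + x ≤ ℓ w) (sym (level ≤-refl)) far)
        where
          open Ascent asc
          below : ∀ {i} → i ≤ 3 + h → ℓ (f i) < ℓ w
          below i≤ = subst (_< ℓ w) (sym (level i≤))
                           (≤-trans (s≤s (+-monoʳ-≤ a i≤)) (≤-trans (n≤1+n _) far))

      jump-via : ∀ {w f g a c p q} → Arc w (f 0) → Ascent f a p → Arc (f p) (g 0) → Ascent g c q →
                 p + q ≡ 2 + h → c + q < a → a + p < ℓ w → Arc w (g q)
      jump-via {w} {f} {g} {a} {c} {p} {q} w→f₀ F f→g G p+q≡ c+q<a a+p<ℓw =
        subst (Arc w) (splice-right p q)
          (arc-to-end (cong suc p+q≡) (subst (Arc w) (sym (splice-left p z≤n)) w→f₀)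
            (splice-chain {R = Arc} p q (Ascent.arc F) f→g (Ascent.arc G))
            (splice-injectiveOn p q (Ascent.injective F) (Ascent.injective G) disjoint)
            (splice-all {P = λ x → ℓ x < ℓ w} p q below-f below-g)
            (subst (λ x → 2 + ℓ x ≤ ℓ w) (sym (splice-right p q))
                   (subst (λ x → 2 + x ≤ ℓ w) (sym (Ascent.level G ≤-refl))
                          (≤-trans (s≤s c+q<a) (≤-trans (s≤s (m≤m+n a p)) a+p<ℓw)))))
        where
          g-low : ∀ {j} → j ≤ q → ℓ (g j) < a
          g-low j≤ = subst (_< a) (sym (Ascent.level G j≤)) (≤-trans (s≤s (+-monoʳ-≤ c j≤)) c+q<a)
          below-f : ∀ {i} → i ≤ p → ℓ (f i) < ℓ w
          below-f i≤ = subst (_< ℓ w) (sym (Ascent.level F i≤)) (≤-trans (s≤s (+-monoʳ-≤ a i≤)) a+p<ℓw)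
          below-g : ∀ {j} → j ≤ q → ℓ (g j) < ℓ w
          below-g j≤ = ≤-trans (g-low j≤) (≤-trans (m≤m+n a p) (<⇒≤ a+p<ℓw))
          disjoint : ∀ {i j} → i ≤ p → j ≤ q → f i ≢ g j
          disjoint i≤ j≤ fᵢ≡gⱼ = <⇒≱ (g-low j≤)
            (subst (a ≤_) (trans (sym (Ascent.level F i≤)) (cong ℓ fᵢ≡gⱼ)) (m≤m+n a _))

      module BackArcs (h-even : 2 ∣ h) {t} (γ : Geodesic t) where
        open Geodesic γ renaming (vertex to g)

        skipᵍ : ∀ {a} → a + (4 + h) ≤ t → Arc (g (a + (4 + h))) (g a)
        skipᵍ {a} bound = subst (Arc (g (a + (4 + h))) ∘ g) (+-identityʳ a) (skip-back (segment γ bound))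

        jumpᵍ : ∀ {w a} → Arc w (g a) → a + (3 + h) ≤ t → 2 + (a + (3 + h)) ≤ ℓ w →
                Arc w (g (a + (3 + h)))
        jumpᵍ {w} {a} w→gₐ bound = jump (subst (Arc w ∘ g) (sym (+-identityʳ a)) w→gₐ) (segment γ bound)

        jump-viaᵍ : ∀ {w a c p q} → Arc w (g a) → a + p ≤ t → Arc (g (a + p)) (g c) →
                    p + q ≡ 2 + h → c + q < a → a + p < ℓ w → Arc w (g (c + q))
        jump-viaᵍ {w} {a} {c} {p} {q} w→gₐ bound junction p+q≡ c+q<a =
          jump-via (subst (Arc w ∘ g) (sym (+-identityʳ a)) w→gₐ) (segment γ bound)
                   (subst (Arc (g (a + p)) ∘ g) (sym (+-identityʳ c)) junction)
                   (segment γ (≤-trans (<⇒≤ c+q<a) (≤-trans (m≤m+n a p) bound))) p+q≡ c+q<a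

        module Base (bound : 6 + h ≤ t) where
          w : Vertex D
          w = g (6 + h)

          in-range : ∀ {x} → x ≤ 6 + h → x ≤ t
          in-range x≤ = ≤-trans x≤ bound

          below : ∀ {x} → x ≤ 6 + h → x ≤ ℓ w
          below = subst (_ ≤_) (sym (geodesic-level γ bound))

          down-two : ∀ {i} → 2 + i ≤ 4 + h → Arc w (g (2 + i)) → Arc w (g i)
          down-two {i} (s≤s (s≤s i≤)) w→ with m≤n⇒∃[o]m+o≡n i≤
          ... | p , i+p≡ =
            jump-viaᵍ {c = 0} {p} {i} w→ (subst (_≤ t) ends (in-range (≤-by 2 (solve (h ∷ [])))))
              (subst (λ x → Arc (g x) (g 0)) ends (skipᵍ {0} (in-range (≤-by 2 (solve (h ∷ []))))))
              (trans (+-comm p i) i+p≡) (n≤1+n (suc i))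
              (subst (_< ℓ w) ends (below (≤-by 1 (solve (h ∷ [])))))
            where
              ends : 4 + h ≡ 2 + i + p
              ends = cong (2 +_) (sym i+p≡)

          w→g₂ : Arc w (g 2)
          w→g₂ = skipᵍ bound

          w→g₀ : Arc w (g 0)
          w→g₀ = down-two (s≤s (s≤s z≤n)) w→g₂

          w→g₃₊ₕ : Arc w (g (3 + h))
          w→g₃₊ₕ = jumpᵍ w→g₀ (in-range (≤-by 3 (solve (h ∷ [])))) (below (≤-by 1 (solve (h ∷ []))))

          -- since h is even, the two-step descent from 3 + h reaches 1
          w→g₁ : Arc w (g 1)
          w→g₁ = downward-induction {P = λ d → Arc w (g (1 + d * 2))}
            (subst (λ x → Arc w (g (3 + x))) h≡e*2 w→g₃₊ₕ)
            (λ {d} d<1+e → down-two (subst (3 + d * 2 ≤_) (cong (4 +_) (sym h≡e*2))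
                                        (s≤s (s≤s (s≤s (m≤n⇒m≤1+n (*-monoˡ-≤ 2 (≤-pred d<1+e))))))))
            (z≤n {suc e})
            where open _∣_ h-even renaming (quotient to e; equality to h≡e*2)

          w→g₄₊ₕ : Arc w (g (4 + h))
          w→g₄₊ₕ = jumpᵍ w→g₁ (in-range (≤-by 2 (solve (h ∷ [])))) (below ≤-refl)

          consecutive : ∀ {i} → i ≤ 3 + h → Arc w (g i) × Arc w (g (suc i))
          consecutive = downward-induction {P = λ i → Arc w (g i) × Arc w (g (suc i))}
            (w→g₃₊ₕ , w→g₄₊ₕ) λ i<3+h (w→gᵢ₊₁ , w→gᵢ₊₂) → down-two (s≤s i<3+h) w→gᵢ₊₂ , w→gᵢ₊₁

          backArcs : ∀ {i} → 2 + i ≤ 6 + h → Arc w (g i)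
          backArcs {zero}  _                       = w→g₀
          backArcs {suc i} (s≤s (s≤s (s≤s i≤3+h))) = proj₂ (consecutive i≤3+h)

        module Step (b : ℕ) (bound : suc (b + (6 + h)) ≤ t)
                    (previous : ∀ {c} → 2 + c ≤ b + (6 + h) → Arc (g (b + (6 + h))) (g c)) where
          w : Vertex D
          w = g (suc (b + (6 + h)))

          in-range : ∀ {x} → x ≤ suc (b + (6 + h)) → x ≤ t
          in-range x≤ = ≤-trans x≤ bound

          below : ∀ {x} → x ≤ suc (b + (6 + h)) → x ≤ ℓ w
          below = subst (_ ≤_) (sym (geodesic-level γ bound))

          slide : ∀ {p q c} → p + q ≡ 2 + h → Arc w (g (4 + b + q)) → c ≤ 3 + b → Arc w (g (c + q))
          slide {p} {q} {c} p+q≡ w→ c≤ =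
            jump-viaᵍ w→ (in-range (subst (_≤ suc (b + (6 + h))) (sym ends) (n≤1+n (b + (6 + h)))))
              (subst (λ x → Arc (g x) (g c)) (sym ends)
                     (previous (≤-trans (s≤s (s≤s c≤)) (≤-by (1 + h) (solve (b ∷ h ∷ []))))))
              p+q≡ (+-monoˡ-≤ q (s≤s c≤)) (subst (_< ℓ w) (sym ends) (below ≤-refl))
            where
              ends : 4 + b + q + p ≡ b + (6 + h)
              ends = begin
                4 + b + q + p     ≡⟨ solve (b ∷ q ∷ p ∷ []) ⟩
                b + (4 + (p + q)) ≡⟨ cong (λ x → b + (4 + x)) p+q≡ ⟩
                b + (6 + h)       ∎

          w→g₃₊ᵦ : Arc w (g (3 + b))
          w→g₃₊ᵦ = subst (λ x → Arc (g x) (g (3 + b))) top≡ (skipᵍ {3 + b} (in-range (≤-reflexive top≡)))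
            where
              top≡ : 3 + b + (4 + h) ≡ suc (b + (6 + h))
              top≡ = solve (b ∷ h ∷ [])

          w→g₁₊ᵦ : Arc w (g (1 + b))
          w→g₁₊ᵦ = subst (Arc w ∘ g) (+-identityʳ (1 + b))
            (jump-viaᵍ {a = 3 + b} {1 + b} {2 + h} {0} w→g₃₊ᵦ (in-range (≤-by 2 (solve (b ∷ h ∷ []))))
              (subst (λ x → Arc (g x) (g (1 + b))) ends
                     (skipᵍ {1 + b} (in-range (≤-by 2 (solve (b ∷ h ∷ []))))))
              (+-identityʳ (2 + h)) (≤-by 1 (solve (b ∷ []))) (below (≤-by 1 (solve (b ∷ h ∷ [])))))
            where
              ends : 1 + b + (4 + h) ≡ 3 + b + (2 + h)
              ends = solve (b ∷ h ∷ [])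

          w→g₄₊ᵦ₊ₕ : Arc w (g (4 + b + h))
          w→g₄₊ᵦ₊ₕ = subst (Arc w ∘ g) ends
            (jumpᵍ {a = 1 + b} w→g₁₊ᵦ (in-range (≤-by 3 (solve (b ∷ h ∷ []))))
                   (below (≤-by 1 (solve (b ∷ h ∷ [])))))
            where
              ends : 1 + b + (3 + h) ≡ 4 + b + h
              ends = solve (b ∷ h ∷ [])

          middle : ∀ {q} → q ≤ h → Arc w (g (4 + b + q))
          middle = downward-induction {P = λ q → Arc w (g (4 + b + q))} w→g₄₊ᵦ₊ₕ descend
            where
              descend : ∀ {q} → q < h → Arc w (g (4 + b + suc q)) → Arc w (g (4 + b + q))
              descend {q} q<h w→ with m≤n⇒∃[o]m+o≡n q<h
              ... | d , 1+q+d≡h = subst (Arc w ∘ g) ends (slide {2 + d} {suc q} {3 + b} p+q≡ w→ ≤-refl)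
                where
                  ends : 3 + b + suc q ≡ 4 + b + q
                  ends = solve (b ∷ q ∷ [])
                  p+q≡ : 2 + d + suc q ≡ 2 + h
                  p+q≡ = begin
                    2 + d + suc q   ≡⟨ solve (d ∷ q ∷ []) ⟩
                    2 + (suc q + d) ≡⟨ cong (2 +_) 1+q+d≡h ⟩
                    2 + h           ∎

          lower : ∀ {c} → c ≤ 3 + b → Arc w (g c)
          lower {c} c≤ = subst (Arc w ∘ g) (+-identityʳ c) (slide (+-identityʳ (2 + h)) (middle z≤n) c≤)

          w→g₅₊ᵦ₊ₕ : Arc w (g (4 + b + suc h))
          w→g₅₊ᵦ₊ₕ = subst (Arc w ∘ g) ends
            (jumpᵍ {a = 2 + b} (lower (n≤1+n (2 + b))) (in-range (≤-by 2 (solve (b ∷ h ∷ []))))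
                   (below (≤-by 0 (solve (b ∷ h ∷ [])))))
            where
              ends : 2 + b + (3 + h) ≡ 4 + b + suc h
              ends = solve (b ∷ h ∷ [])

          backArcs : ∀ {i} → 2 + i ≤ suc (b + (6 + h)) → Arc w (g i)
          backArcs {i} 2+i≤ with i ≤? 3 + b
          ... | yes i≤ = lower i≤
          ... | no  i≰ with m≤n⇒∃[o]m+o≡n (≰⇒> i≰)
          ...   | q , refl with q ≤? h
          ...     | yes q≤h = middle q≤h
          ...     | no  q≰h = subst (Arc w ∘ g) (cong (4 + b +_) (sym q≡1+h)) w→g₅₊ᵦ₊ₕ
            where
              top≡ : suc (b + (6 + h)) ≡ 6 + b + suc h
              top≡ = solve (b ∷ h ∷ [])
              q≡1+h : q ≡ suc h
              q≡1+h = ≤-antisym (+-cancelˡ-≤ (6 + b) q (suc h) (subst (6 + b + q ≤_) top≡ 2+i≤)) (≰⇒> q≰h)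

        backArcs : ∀ b → b + (6 + h) ≤ t → ∀ {i} → 2 + i ≤ b + (6 + h) → Arc (g (b + (6 + h))) (g i)
        backArcs zero    bound = Base.backArcs bound
        backArcs (suc b) bound = Step.backArcs b bound (backArcs b (<⇒≤ bound))

        backArc : ∀ {m} → 6 + h ≤ m → m ≤ t → ∀ {i} → 2 + i ≤ m → Arc (g m) (g i)
        backArc deep with m≤n⇒∃[o]m+o≡n deep
        ... | b , refl = subst (λ m → m ≤ t → ∀ {i} → 2 + i ≤ m → Arc (g m) (g i)) (+-comm b (6 + h))
                               (backArcs b)

      module Deep (h-even : 2 ∣ h) where

        deep-arc : ∀ {w} → 6 + h ≤ ℓ w → ∀ {z} → 2 + ℓ z ≤ ℓ w → Arc w z
        deep-arc {w} deep {z} = <-rec Dominated dominated (ℓ z) refl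
          where
            Dominated : ℕ → Set
            Dominated a = ∀ {z} → ℓ z ≡ a → 2 + a ≤ ℓ w → Arc w z

            X : Geodesic (ℓ w)
            X = proj₁ (geodesicTo w)

            x : ℕ → Vertex D
            x = Geodesic.vertex X

            4+h≤ℓw : 4 + h ≤ ℓ w
            4+h≤ℓw = ≤-trans (m≤n⇒m≤1+n (n≤1+n (4 + h))) deep

            w→x : ∀ {i} → 2 + i ≤ ℓ w → Arc w (x i)
            w→x {i} = subst (λ y → Arc y (x i)) (proj₂ (geodesicTo w))
                    ∘ BackArcs.backArc h-even X deep ≤-refl

            shallow : ∀ {z a} → ℓ z ≡ a → a ≤ 2 + h → Arc w z
            shallow {z} {a} ℓz≡a a≤ with geodesicTo z | m≤n⇒∃[o]m+o≡n a≤
            ... | Y , Y≡z | p , a+p≡ = subst (Arc w) (trans (cong y (sym ℓz≡a)) Y≡z)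
              (jump-via {a = 2 + a} {c = 0} {p} {a}
                (subst (Arc w ∘ x) (sym (+-identityʳ (2 + a)))
                       (w→x (≤-trans (s≤s (s≤s (s≤s (s≤s a≤)))) deep)))
                (segment X (subst (_≤ ℓ w) ends 4+h≤ℓw))
                (subst₂ (λ i y → Arc (x i) y) ends (trans (sym (Geodesic.start X)) (Geodesic.start Y))
                        (skip-back (segment X {0} {4 + h} 4+h≤ℓw)))
                (segment Y (≤-reflexive (sym ℓz≡a)))
                (trans (+-comm p a) a+p≡) (n≤1+n (suc a))
                (subst (_< ℓ w) ends (≤-trans (n≤1+n (5 + h)) deep)))
              where
                y : ℕ → Vertex D
                y = Geodesic.vertex Y
                ends : 4 + h ≡ 2 + a + p
                ends = cong (2 +_) (sym a+p≡)

            dominated : ∀ a → (∀ {b} → b < a → Dominated b) → Dominated a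
            dominated a previous {z} ℓz≡a near with a ≤? 2 + h
            ... | yes a≤ = shallow ℓz≡a a≤
            ... | no  a≰ with m≤n⇒∃[o]m+o≡n (≰⇒> a≰) | geodesicTo z
            ...   | b , refl | Y , Y≡z =
              subst (Arc w) (trans (cong y (trans (+-comm b (3 + h)) (sym ℓz≡a))) Y≡z)
                (jump {a = b}
                  (subst (Arc w ∘ y) (sym (+-identityʳ b))
                         (previous (s≤s (m≤n+m b (2 + h)))
                                   (geodesic-level Y (subst (b ≤_) (sym ℓz≡a) (m≤n+m b (3 + h))))
                                   (≤-trans (s≤s (s≤s (m≤n+m b (3 + h)))) near)))
                  (segment Y (≤-reflexive (trans (+-comm b (3 + h)) (sym ℓz≡a))))
                  (subst (λ i → 2 + i ≤ ℓ w) (+-comm (3 + h) b) near))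
              where
                y : ℕ → Vertex D
                y = Geodesic.vertex Y

        same-level-adjacent : ∀ {y y′} → 6 + h ≤ ℓ y → ℓ y′ ≡ ℓ y → y′ ≢ y → Arc y′ y ⊎ Arc y y′
        same-level-adjacent {y} {y′} deep ℓ≡ y′≢y
          with geodesicTo y | m≤n⇒∃[o]m+o≡n (≤-trans (m≤n+m (3 + h) 3) deep)
        ... | Y , Y≡y | c , 3+h+c≡ = subst (λ z → Arc y′ z ⊎ Arc z y′) (trans (cong g top≡) Y≡y)
          (qt-sequence {y′ ◃ λ i → g (c + i)} refl (◃-chain {R = Arc} y′→ (Ascent.arc run))
                       (◃-injectiveOn avoids (Ascent.injective run)))
          where
            g : ℕ → Vertex D
            g = Geodesic.vertex Y
            top≡ : c + (3 + h) ≡ ℓ y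
            top≡ = trans (+-comm c (3 + h)) 3+h+c≡
            run : Ascent (λ i → g (c + i)) c (3 + h)
            run = segment Y (≤-reflexive top≡)
            near : 2 + (c + 0) ≤ c + (3 + h)
            near = ≤-by (1 + h) (solve (c ∷ h ∷ []))
            y′→ : Arc y′ (g (c + 0))
            y′→ = deep-arc (subst (6 + h ≤_) (sym ℓ≡) deep)
              (subst₂ (λ l m → 2 + l ≤ m) (sym (Ascent.level run z≤n)) (trans top≡ (sym ℓ≡)) near)
            avoids : ∀ {i} → i ≤ 3 + h → g (c + i) ≢ y′
            avoids {i} i≤ eq =
              y′≢y (trans (sym eq) (trans (cong (λ j → g (c + j)) i≡) (trans (cong g top≡) Y≡y)))
              where
                i≡ : i ≡ 3 + h
                i≡ = +-cancelˡ-≡ c _ _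
                  (trans (sym (Ascent.level run i≤)) (trans (cong ℓ eq) (trans ℓ≡ (sym top≡))))

        deep-walk : ∀ {w} → 6 + h ≤ ℓ w → ∀ j {a t} → 2 + a ≤ ℓ w → ℓ t ≤ j + a → w ⇝[ suc j ] t
        deep-walk deep zero    near ℓt≤a = ⇝-snoc refl (deep-arc deep (≤-trans (s≤s (s≤s ℓt≤a)) near))
        deep-walk deep (suc j) {a} {t} near ℓt≤ with ℓ t ≤? j + a
        ... | yes ℓt≤′ = ⇝-mono (n≤1+n _) (deep-walk deep j near ℓt≤′)
        ... | no  ℓt≰ with parent (subst (IsDistance t) (≤-antisym ℓt≤ (≰⇒> ℓt≰)) (ℓ-isDistance t))
        ...   | x , x-dist , x→t = ⇝-snoc (deep-walk deep j near (≤-reflexive (ℓ-unique x-dist))) x→t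

        deepest-3-king : ∀ {w} → 6 + h ≤ ℓ w → (∀ t → ℓ t ≤ ℓ w) → ∀ t → w ⇝[ 3 ] t
        deepest-3-king deep deepest t with m≤n⇒∃[o]m+o≡n (≤-trans (m≤m+n 2 (4 + h)) deep)
        ... | a , 2+a≡ℓw =
          deep-walk deep 2 (≤-reflexive 2+a≡ℓw) (subst (ℓ t ≤_) (sym 2+a≡ℓw) (deepest t))

        top-2-king : ∀ {m x₀} → 6 + h ≤ m → (∀ t → ℓ t ≤ m) → ℓ x₀ ≡ m →
                     ∃[ u ] ℓ u ≡ m × ∀ t → u ⇝[ 2 ] t
        top-2-king {m} deep bounded ℓx₀≡m =
          let u , ℓu≡m , king-of-top = semicomplete-king (λ x → ℓ x ≟ℕ m) adjacent ℓx₀≡m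
          in u , ℓu≡m , λ t → case ℓ t ≟ℕ m of λ
               { (yes ℓt≡m) → king-of-top ℓt≡m
               ; (no  ℓt≢m) → below ℓu≡m (≤∧≢⇒< (bounded t) ℓt≢m) }
          where
            adjacent : ∀ {x y} → ℓ x ≡ m → ℓ y ≡ m → x ≢ y → Arc x y ⊎ Arc y x
            adjacent ℓx≡m ℓy≡m =
              same-level-adjacent (subst (6 + h ≤_) (sym ℓy≡m) deep) (trans ℓx≡m (sym ℓy≡m))
            below : ∀ {u t} → ℓ u ≡ m → ℓ t < m → u ⇝[ 2 ] t
            below {u} {t} ℓu≡m ℓt<m with m≤n⇒∃[o]m+o≡n (≤-trans (m≤m+n 2 (4 + h)) deep)
            ... | a , 2+a≡m = deep-walk (subst (6 + h ≤_) (sym ℓu≡m) deep) 1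
              (≤-reflexive (trans 2+a≡m (sym ℓu≡m))) (≤-pred (subst (ℓ t <_) (sym 2+a≡m) ℓt<m))

  module Kings (h : ℕ) (h-even : 2 ∣ h) (qt : IsQuasiTransitive D (4 + h))
               (C : Vertex D → Set) (C-unique : IsUniqueInitialStrongComponent D C) where
    open QuasiTransitive h qt
    open InitialComponent C C-unique

    IsWalkKing : ℕ → Vertex D → Set
    IsWalkKing r w = ∀ t → w ⇝[ r ] t

    walkKing? : ∀ r w → Dec (IsWalkKing r w)
    walkKing? r w = all? (walk? w r)

    walkKing⇒king : ∀ {r s w} → r ≤ s → IsWalkKing r w → IsKing D s w
    walkKing⇒king r≤s king t = Distance.walk⇒distLe _ (⇝-mono r≤s (king t))

    k+1≡ : 4 + h + 1 ≡ 5 + h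
    k+1≡ = solve (h ∷ [])

    k+2≡ : 4 + h + 2 ≡ 6 + h
    k+2≡ = solve (h ∷ [])

    CrossingArc : Set
    CrossingArc = ∃[ u₂ ] ∃[ u₁ ] Arc u₂ u₁ × C u₁ × ¬ IsWalkKing (5 + h) u₂ × IsWalkKing (5 + h) u₁

    module FromMember {c} (Cc : C c) where
      open Rooted c (member-reaches Cc) public
      open Deep h-even public

    non-king⇒crossing : ∀ {c} → C c → ¬ IsWalkKing (5 + h) c → CrossingArc
    non-king⇒crossing {c} Cc ¬king = from-deepest (maximum ℓ c)
      where
        open FromMember Cc

        from-deepest : (∃[ w ] ∀ t → ℓ t ≤ ℓ w) → CrossingArc
        from-deepest (w₀ , deepest) =
          crossing (crossing-arc (walkKing? (5 + h)) (ℓ-walk w₀) ¬king w₀-king)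
          where
            deep : 6 + h ≤ ℓ w₀
            deep = ≰⇒> λ ℓw₀≤5+h → ¬king λ t → ⇝-mono (≤-trans (deepest t) ℓw₀≤5+h) (ℓ-walk t)

            w₀-king : IsWalkKing (5 + h) w₀
            w₀-king t = ⇝-mono (m≤m+n 3 (2 + h)) (deepest-3-king deep deepest t)

            w₀→c : Arc w₀ c
            w₀→c = deep-arc deep
              (≤-trans (s≤s (s≤s (ℓ-minimal {0} refl))) (≤-trans (m≤m+n 2 (4 + h)) deep))

            crossing : (∃[ x ] ∃[ y ] Arc x y × ¬ IsWalkKing (5 + h) x × IsWalkKing (5 + h) y × y ⇝ w₀) →
                       CrossingArc
            crossing (u₂ , u₁ , u₂→u₁ , ¬king₂ , king₁ , u₁⇝w₀) =
              u₂ , u₁ , u₂→u₁ , reaches-member Cc (reach-trans u₁⇝w₀ (arc⇒reach w₀→c)) , ¬king₂ , king₁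

    SecondAlternative : Set
    SecondAlternative = Σ (Vertex D) (λ u₁ → Σ (Vertex D) (λ u₂ → Σ (Vertex D) (λ u₃ →
      C u₁ × C u₂ × C u₃
      × IsKing D (4 + h + 1) u₁
      × IsKing D (4 + h + 2) u₂
      × Arc u₂ u₁
      × DistEq D u₂ u₃ (4 + h + 2)
      × IsKing D 2 u₃
      × ((w : Vertex D) → DistEq D u₂ w (4 + h + 2) → IsKing D 3 w))))

    crossing⇒second-alternative : CrossingArc → SecondAlternative
    crossing⇒second-alternative (u₂ , u₁ , u₂→u₁ , Cu₁ , ¬king₂ , king₁) =
      from-top (top-2-king ≤-refl bounded (proj₂ farthest))
      where
        Cu₂ : C u₂
        Cu₂ = reaches-member Cu₁ (arc⇒reach u₂→u₁)

        open FromMember Cu₂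

        king₂ : IsWalkKing (6 + h) u₂
        king₂ t = ⇝-cons u₂→u₁ (king₁ t)

        bounded : ∀ t → ℓ t ≤ 6 + h
        bounded t = ℓ-minimal (king₂ t)

        farthest : ∃[ t ] ℓ t ≡ 6 + h
        farthest = let t , ¬walk = ¬∀⟶∃¬ n _ (walk? u₂ (5 + h)) ¬king₂
                   in t , ≤-antisym (bounded t) (≰⇒> λ ℓt≤ → ¬walk (⇝-mono ℓt≤ (ℓ-walk t)))

        from-top : (∃[ u ] ℓ u ≡ 6 + h × IsWalkKing 2 u) → SecondAlternative
        from-top (u₃ , ℓu₃≡ , king₃) =
          u₁ , u₂ , u₃ , Cu₁ , Cu₂ , reaches-member Cu₂ (arc⇒reach u₃→u₂) ,
          walkKing⇒king (≤-reflexive (sym k+1≡)) king₁ ,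
          walkKing⇒king (≤-reflexive (sym k+2≡)) king₂ ,
          u₂→u₁ ,
          level⇒distEq (trans ℓu₃≡ (sym k+2≡)) ,
          walkKing⇒king ≤-refl king₃ ,
          λ w dist → let ℓw≡ = trans (distEq⇒level dist) k+2≡ in walkKing⇒king ≤-refl
            (deepest-3-king (≤-reflexive (sym ℓw≡)) λ t → subst (ℓ t ≤_) (sym ℓw≡) (bounded t))
          where
            u₃→u₂ : Arc u₃ u₂
            u₃→u₂ = deep-arc (≤-reflexive (sym ℓu₃≡))
              (subst (2 + ℓ u₂ ≤_) (sym ℓu₃≡) (s≤s (s≤s (≤-trans (ℓ-minimal {0} refl) z≤n))))

    all-kings⊎crossing : (∀ v → C v → IsWalkKing (5 + h) v) ⊎ CrossingArc
    all-kings⊎crossing = decide (any? λ v → reach? v c₀ ×-dec ¬? (walkKing? (5 + h) v))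
      where
        open IsStrongComponent (IsInitialStrongComponent.isSC (proj₁ C-unique)) using (nonempty)

        c₀ : Vertex D
        c₀ = proj₁ nonempty

        decide : Dec (∃[ v ] v ⇝ c₀ × ¬ IsWalkKing (5 + h) v) →
                 (∀ v → C v → IsWalkKing (5 + h) v) ⊎ CrossingArc
        decide (yes (v , v⇝c₀ , ¬king)) =
          inj₂ (non-king⇒crossing (reaches-member (proj₂ nonempty) v⇝c₀) ¬king)
        decide (no  none) = inj₁ λ v Cv →
          decidable-stable (walkKing? (5 + h) v) λ ¬king → none (v , member-reaches Cv c₀ , ¬king)

mainTheorem12 : (k : ℕ) → 4 ≤ k → 2 ∣ k →
    (D : Digraph) → IsQuasiTransitive D k →
    (C : Vertex D → Set) → IsUniqueInitialStrongComponent D C →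
    ((v : Vertex D) → C v → IsKing D (k + 1) v)
    ⊎ Σ (Vertex D) (λ u₁ → Σ (Vertex D) (λ u₂ → Σ (Vertex D) (λ u₃ →
        C u₁ × C u₂ × C u₃
        × IsKing D (k + 1) u₁
        × IsKing D (k + 2) u₂
        × Digraph.Arc D u₂ u₁
        × DistEq D u₂ u₃ (k + 2)
        × IsKing D 2 u₃
        × ((w : Vertex D) → DistEq D u₂ w (k + 2) → IsKing D 3 w))))
mainTheorem12 k 4≤k 2∣k D qt C C-unique with m≤n⇒∃[o]m+o≡n 4≤k
... | h , refl = Sum.map (λ kings v Cv → walkKing⇒king (≤-reflexive (sym k+1≡)) (kings v Cv))
                         crossing⇒second-alternative all-kings⊎crossing
  where open Kings D h (∣m+n∣m⇒∣n 2∣k (divides 2 refl)) qt C C-unique
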